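{- Let $N \equiv 2 \pmod 4$. Let $EOEO$ and $OEOE$ denote the numbers of partitions of $N$ into exactly two part sizes lying in the respective parity classes. Then $$EOEO = OEOE + \frac{\sigma_1(N/2)}{2} - \frac{d(N)}{4},$$ where $d$ is the number-of-divisors function and $\sigma_1$ is the sum-of-divisors function.
   Context: A partition with exactly two part sizes is written $(\lambda_1^{m_1}\lambda_2^{m_2})$ with $\lambda_1>\lambda_2\ge1$ the part sizes and $m_1,m_2\ge1$ their multiplicities. Its parity class is the word $ABCD$ over $\{O,E\}$ where $A,B,C,D$ record whether $\lambda_1, m_1, \lambda_2, m_2$ respectively are odd ($O$) or even ($E$). -}

module Defs where

open import Data.Nat using (ℕ; zero; suc; _+_; _*_; _<_; _<ᵇ_; _≡ᵇ_; _%_)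
open import Data.Nat.Divisibility using (_∣?_)
open import Data.Bool using (Bool; true; false; _∧_; if_then_else_)
open import Data.List using (List; length; filter; map; concatMap; applyUpTo)
open import Data.Nat.ListAction using (sum)
open import Relation.Nullary.Decidable using (⌊_⌋)

data Parity : Set where
  O E : Parity

parity : ℕ → Parity
parity n with n % 2
... | zero = E
... | suc _ = O

_≟ₚ_ : Parity → Parity → Bool
O ≟ₚ O = true
E ≟ₚ E = true
_ ≟ₚ _ = false

-- A partition with exactly two part sizes, (λ₁^m₁ λ₂^m₂), is encoded by
-- the quadruple (λ₁ , m₁ , λ₂ , m₂) with λ₁ > λ₂ ≥ 1, m₁ , m₂ ≥ 1.
record TwoSize : Set where
  constructor ts
  field
    l₁ m₁ l₂ m₂ : ℕ

range1 : ℕ → List ℕ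
range1 n = applyUpTo suc n

-- All partitions of N into exactly two part sizes: every entry of the
-- quadruple is at most N, so enumerating 1..N for each suffices.
isTwoSizePartitionOf : ℕ → TwoSize → Bool
isTwoSizePartitionOf N (ts a b c d) = (c <ᵇ a) ∧ ((a * b + c * d) ≡ᵇ N)

twoSizePartitions : ℕ → List TwoSize
twoSizePartitions N =
  filter (λ p → isTwoSizePartitionOf N p Data.Bool.≟ true)
    (concatMap (λ a → concatMap (λ b → concatMap (λ c → map (λ d → ts a b c d)
      (range1 N)) (range1 N)) (range1 N)) (range1 N))

hasClass : Parity → Parity → Parity → Parity → TwoSize → Bool
hasClass A B C D (ts a b c d) =
  (parity a ≟ₚ A) ∧ (parity b ≟ₚ B) ∧ (parity c ≟ₚ C) ∧ (parity d ≟ₚ D)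

countClass : Parity → Parity → Parity → Parity → ℕ → ℕ
countClass A B C D N =
  length (filter (λ p → hasClass A B C D p Data.Bool.≟ true) (twoSizePartitions N))

divisors : ℕ → List ℕ
divisors n = filter (λ k → k ∣? n) (range1 n)

numDivisors : ℕ → ℕ
numDivisors n = length (divisors n)

sigma1 : ℕ → ℕ
sigma1 n = sum (divisors n)

-- Write N = 2M with M odd, and count as sums of indicators over [1 … N]⁴ the solutions
-- (λ₁, m₁, λ₂, m₂) of λ₁m₁ + λ₂m₂ = N of class ABAB, without requiring λ₁ > λ₂. Exchanging the
-- blocks (λ₁, m₁) and (λ₂, m₂) shows that there are 2·ABAB of them plus those with λ₁ = λ₂, and
-- exchanging sizes with multiplicities, (λ, m) ↦ (m, λ), matches the EOEO solutions with the OEOE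
-- ones. An EOEO solution with λ₁ = λ₂ would give 4 ∣ N, so 2·EOEO = 2·OEOE + D, where D counts
-- λ(m₁ + m₂) = N with λ odd and m₁, m₂ even, i.e. the triples with λ(i + j) = M. Grouping them by
-- s = i + j ∣ M gives D = Σ_{s ∣ M} (s − 1) = σ₁(M) − d(M), and d(N) = 2 d(M) because M is odd.

module Submission where

open import Defs
open TwoSize

open import Data.Bool using (Bool; true; false; _∧_)
import Data.Bool as Bool
open import Data.Bool.Properties using (∧-assoc; ∧-comm)
open import Data.List using (List; []; _∷_; _++_; [_]; length; filter; map; concatMap)
open import Data.List.Properties using (map-++; map-∘; map-id; map-cong; applyUpTo-∷ʳ)
open import Data.Nat
  using (ℕ; zero; suc; _+_; _*_; _⊓_; _<_; _≤_; _<ᵇ_; _≡ᵇ_; z≤n; s≤s; s≤s⁻¹; z<s; _≟_; _<?_; >-nonZero)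
open import Data.Nat.Divisibility
  using (_∣_; _∣?_; divides; >⇒∤; ∣n⇒∣m*n; *-cancelˡ-∣; *-monoʳ-∣)
open import Data.Nat.ListAction using (sum)
open import Data.Nat.ListAction.Properties using (sum-++)
open import Data.Nat.Properties
open import Data.Nat.Tactic.RingSolver using (solve-∀)
open import Data.Sum using (inj₁; inj₂)
open import Function using (id; _∘_)
open import Function.Bundles using (mk⇔)
open import Level using (0ℓ)
open import Relation.Binary using (tri<; tri≈; tri>)
open import Relation.Binary.PropositionalEquality hiding ([_])
open import Relation.Nullary using (Dec; yes; no; does; ¬_; contradiction)
open import Relation.Nullary.Decidable using (dec-true; dec-false; does-⇔)
open import Relation.Unary using (Pred; Decidable)
open import Algebra.Properties.CommutativeSemigroup +-commutativeSemigroup using (interchange)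

𝟙 : Bool → ℕ
𝟙 false = 0
𝟙 true  = 1

𝟙-∧ : ∀ x y → 𝟙 (x ∧ y) ≡ 𝟙 x * 𝟙 y
𝟙-∧ false y = refl
𝟙-∧ true  y = sym (+-identityʳ (𝟙 y))

does-≟true : ∀ b → does (b Bool.≟ true) ≡ b
does-≟true false = refl
does-≟true true  = refl

-- does (m <? n) and does (m ≟ n) are definitionally m <ᵇ n and m ≡ᵇ n.
𝟙-trichotomy : ∀ m n x →
  𝟙 x ≡ 𝟙 (does (n <? m) ∧ x) + 𝟙 (does (m <? n) ∧ x) + 𝟙 (does (m ≟ n) ∧ x)
𝟙-trichotomy m n x with <-cmp m n
... | tri< m<n m≢n n≮m
  rewrite dec-false (n <? m) n≮m | dec-true (m <? n) m<n | dec-false (m ≟ n) m≢n =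
  sym (+-identityʳ (𝟙 x))
... | tri≈ m≮n m≡n n≮m
  rewrite dec-false (n <? m) n≮m | dec-false (m <? n) m≮n | dec-true (m ≟ n) m≡n =
  refl
... | tri> m≮n m≢n n<m
  rewrite dec-true (n <? m) n<m | dec-false (m <? n) m≮n | dec-false (m ≟ n) m≢n =
  sym (trans (+-identityʳ (𝟙 x + 0)) (+-identityʳ (𝟙 x)))

∧-swapPairs : ∀ p q r s → p ∧ (q ∧ (r ∧ s)) ≡ r ∧ (s ∧ (p ∧ q))
∧-swapPairs p q r s =
  trans (sym (∧-assoc p q (r ∧ s))) (trans (∧-comm (p ∧ q) (r ∧ s)) (∧-assoc r s (p ∧ q)))

∧-swapWithinPairs : ∀ p q r s → p ∧ (q ∧ (r ∧ s)) ≡ q ∧ (p ∧ (s ∧ r))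
∧-swapWithinPairs p q r s =
  trans (sym (∧-assoc p q (r ∧ s)))
        (trans (cong₂ _∧_ (∧-comm p q) (∧-comm r s)) (∧-assoc q p (s ∧ r)))

-- ∑[ x ≤ n ] f x = f 1 + ⋯ + f n: the index 0 is not included.
∑ : ℕ → (ℕ → ℕ) → ℕ
∑ zero    f = 0
∑ (suc n) f = ∑ n f + f (suc n)

syntax ∑ n (λ x → e) = ∑[ x ≤ n ] e

∑-cong-≤ : ∀ n {f g : ℕ → ℕ} → (∀ x → 0 < x → x ≤ n → f x ≡ g x) → ∑ n f ≡ ∑ n g
∑-cong-≤ zero    f≡g = refl
∑-cong-≤ (suc n) f≡g =
  cong₂ _+_ (∑-cong-≤ n λ x 0<x x≤n → f≡g x 0<x (m≤n⇒m≤1+n x≤n)) (f≡g (suc n) z<s ≤-refl)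

∑-cong : ∀ n {f g : ℕ → ℕ} → f ≗ g → ∑ n f ≡ ∑ n g
∑-cong n f≗g = ∑-cong-≤ n λ x _ _ → f≗g x

∑-vanishing : ∀ n {f : ℕ → ℕ} → (∀ x → 0 < x → x ≤ n → f x ≡ 0) → ∑ n f ≡ 0
∑-vanishing zero    f≡0 = refl
∑-vanishing (suc n) f≡0 =
  cong₂ _+_ (∑-vanishing n λ x 0<x x≤n → f≡0 x 0<x (m≤n⇒m≤1+n x≤n)) (f≡0 (suc n) z<s ≤-refl)

∑-distrib-+ : ∀ n (f g : ℕ → ℕ) → ∑[ x ≤ n ] (f x + g x) ≡ ∑ n f + ∑ n g
∑-distrib-+ zero    f g = refl
∑-distrib-+ (suc n) f g = trans (cong (_+ (f (suc n) + g (suc n))) (∑-distrib-+ n f g))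
                                (interchange (∑ n f) (∑ n g) (f (suc n)) (g (suc n)))

∑-distribʳ-* : ∀ n c (f : ℕ → ℕ) → ∑[ x ≤ n ] (f x * c) ≡ ∑ n f * c
∑-distribʳ-* zero    c f = refl
∑-distribʳ-* (suc n) c f = trans (cong (_+ f (suc n) * c) (∑-distribʳ-* n c f))
                                 (sym (*-distribʳ-+ c (∑ n f) (f (suc n))))

∑-comm : ∀ m n (f : ℕ → ℕ → ℕ) → ∑[ x ≤ m ] ∑[ y ≤ n ] f x y ≡ ∑[ y ≤ n ] ∑[ x ≤ m ] f x y
∑-comm zero    n f = sym (∑-vanishing n λ _ _ _ → refl)
∑-comm (suc m) n f = trans (cong (_+ ∑[ y ≤ n ] f (suc m) y) (∑-comm m n f))
                           (sym (∑-distrib-+ n (λ y → ∑[ x ≤ m ] f x y) (f (suc m))))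

∑-δ : ∀ n {s} (f : ℕ → ℕ) → 0 < s → s ≤ n → ∑[ t ≤ n ] (𝟙 (s ≡ᵇ t) * f t) ≡ f s
∑-δ zero    f (s≤s _) ()
∑-δ (suc n) {s} f 0<s s≤1+n with m≤n⇒m<n∨m≡n s≤1+n
... | inj₁ (s≤s s≤n) = begin
  ∑[ t ≤ n ] (𝟙 (s ≡ᵇ t) * f t) + 𝟙 (s ≡ᵇ suc n) * f (suc n)
    ≡⟨ cong₂ (λ x b → x + 𝟙 b * f (suc n))
             (∑-δ n f 0<s s≤n) (dec-false (s ≟ suc n) (<⇒≢ (s≤s s≤n))) ⟩
  f s + 0
    ≡⟨ +-identityʳ (f s) ⟩
  f s ∎
  where open ≡-Reasoning
... | inj₂ refl = begin
  ∑[ t ≤ n ] (𝟙 (suc n ≡ᵇ t) * f t) + 𝟙 (n ≡ᵇ n) * f (suc n)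
    ≡⟨ cong₂ (λ x b → x + 𝟙 b * f (suc n)) off-diagonal (dec-true (n ≟ n) refl) ⟩
  f (suc n) + 0
    ≡⟨ +-identityʳ (f (suc n)) ⟩
  f (suc n) ∎
  where
  open ≡-Reasoning
  off-diagonal : ∑[ t ≤ n ] (𝟙 (suc n ≡ᵇ t) * f t) ≡ 0
  off-diagonal = ∑-vanishing n λ t _ t≤n →
    cong (λ b → 𝟙 b * f t) (dec-false (suc n ≟ t) (≢-sym (<⇒≢ (s≤s t≤n))))

∑-extend : ∀ {m n} {f : ℕ → ℕ} → m ≤ n → (∀ x → m < x → f x ≡ 0) → ∑ n f ≡ ∑ m f
∑-extend {n = zero}  z≤n _ = refl
∑-extend {m} {suc n} m≤1+n f≡0 with m≤n⇒m<n∨m≡n m≤1+n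
... | inj₁ m<1+n = trans (cong₂ _+_ (∑-extend (s≤s⁻¹ m<1+n) f≡0) (f≡0 (suc n) m<1+n))
                         (+-identityʳ _)
... | inj₂ refl  = refl

∑-evens : ∀ m (f : ℕ → ℕ) → (∀ j → f (1 + 2 * j) ≡ 0) → ∑ (2 * m) f ≡ ∑[ j ≤ m ] f (2 * j)
∑-evens zero    f odd≡0 = refl
∑-evens (suc m) f odd≡0 = begin
  ∑ (2 * suc m) f
    ≡⟨ cong (λ k → ∑ k f) (*-suc 2 m) ⟩
  ∑ (2 * m) f + f (1 + 2 * m) + f (2 + 2 * m)
    ≡⟨ cong (_+ f (2 + 2 * m)) (trans (cong (∑ (2 * m) f +_) (odd≡0 m)) (+-identityʳ _)) ⟩
  ∑ (2 * m) f + f (2 + 2 * m)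
    ≡⟨ cong₂ _+_ (∑-evens m f odd≡0) (cong f (sym (*-suc 2 m))) ⟩
  ∑[ j ≤ suc m ] f (2 * j) ∎
  where open ≡-Reasoning

n⊓t+[n<t]≡[1+n]⊓t : ∀ n t → n ⊓ t + 𝟙 (n <ᵇ t) ≡ suc n ⊓ t
n⊓t+[n<t]≡[1+n]⊓t zero    zero    = refl
n⊓t+[n<t]≡[1+n]⊓t zero    (suc t) = refl
n⊓t+[n<t]≡[1+n]⊓t (suc n) zero    = refl
n⊓t+[n<t]≡[1+n]⊓t (suc n) (suc t) = cong suc (n⊓t+[n<t]≡[1+n]⊓t n t)

∑-<ᵇ : ∀ n t → ∑[ i ≤ n ] 𝟙 (i <ᵇ suc t) ≡ n ⊓ t
∑-<ᵇ zero    t = refl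
∑-<ᵇ (suc n) t = trans (cong (_+ 𝟙 (n <ᵇ t)) (∑-<ᵇ n t)) (n⊓t+[n<t]≡[1+n]⊓t n t)

∑-shift : ∀ i n (g : ℕ → ℕ) → ∑[ j ≤ n ] g (i + j) ≡ ∑[ t ≤ i + n ] (𝟙 (i <ᵇ t) * g t)
∑-shift i zero    g = sym (∑-vanishing (i + 0) λ t _ t≤i+0 →
  cong (λ b → 𝟙 b * g t) (dec-false (i <? t) (≤⇒≯ (subst (t ≤_) (+-identityʳ i) t≤i+0))))
∑-shift i (suc n) g = begin
  ∑[ j ≤ n ] g (i + j) + g (i + suc n)
    ≡⟨ cong₂ _+_ (∑-shift i n g) (cong g (+-suc i n)) ⟩
  ∑[ t ≤ i + n ] (𝟙 (i <ᵇ t) * g t) + g (suc (i + n))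
    ≡⟨ cong (∑[ t ≤ i + n ] (𝟙 (i <ᵇ t) * g t) +_) (sym (trans
         (cong (λ b → 𝟙 b * g (suc (i + n))) (dec-true (i <? suc (i + n)) (s≤s (m≤m+n i n))))
         (*-identityˡ _))) ⟩
  ∑[ t ≤ suc (i + n) ] (𝟙 (i <ᵇ t) * g t)
    ≡⟨ cong (λ k → ∑[ t ≤ k ] (𝟙 (i <ᵇ t) * g t)) (sym (+-suc i n)) ⟩
  ∑[ t ≤ i + suc n ] (𝟙 (i <ᵇ t) * g t) ∎
  where open ≡-Reasoning

∑∑-convolution : ∀ n (g : ℕ → ℕ) → (∀ t → n < t → g t ≡ 0) →
                 ∑ n g + ∑[ i ≤ n ] ∑[ j ≤ n ] g (i + j) ≡ ∑[ t ≤ n ] (t * g t)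
∑∑-convolution n g g≡0 = begin
  ∑ n g + ∑[ i ≤ n ] ∑[ j ≤ n ] g (i + j)
    ≡⟨ cong (∑ n g +_) (∑-cong n shifted) ⟩
  ∑ n g + ∑[ i ≤ n ] ∑[ t ≤ n ] (𝟙 (i <ᵇ t) * g t)
    ≡⟨ cong (∑ n g +_) (∑-comm n n _) ⟩
  ∑ n g + ∑[ t ≤ n ] ∑[ i ≤ n ] (𝟙 (i <ᵇ t) * g t)
    ≡⟨ cong (∑ n g +_) (∑-cong n λ t → ∑-distribʳ-* n (g t) (λ i → 𝟙 (i <ᵇ t))) ⟩
  ∑ n g + ∑[ t ≤ n ] (∑[ i ≤ n ] 𝟙 (i <ᵇ t) * g t)
    ≡⟨ sym (∑-distrib-+ n g _) ⟩
  ∑[ t ≤ n ] (suc (∑[ i ≤ n ] 𝟙 (i <ᵇ t)) * g t)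
    ≡⟨ ∑-cong-≤ n smaller-count ⟩
  ∑[ t ≤ n ] (t * g t) ∎
  where
  open ≡-Reasoning
  shifted : ∀ i → ∑[ j ≤ n ] g (i + j) ≡ ∑[ t ≤ n ] (𝟙 (i <ᵇ t) * g t)
  shifted i = trans (∑-shift i n g)
    (∑-extend (m≤n+m n i) λ t n<t → trans (cong (𝟙 (i <ᵇ t) *_) (g≡0 t n<t)) (*-zeroʳ (𝟙 (i <ᵇ t))))
  smaller-count : ∀ t → 0 < t → t ≤ n → suc (∑[ i ≤ n ] 𝟙 (i <ᵇ t)) * g t ≡ t * g t
  smaller-count (suc t) _ t<n =
    cong (λ c → suc c * g (suc t)) (trans (∑-<ᵇ n t) (m≥n⇒m⊓n≡n (<⇒≤ t<n)))

∑-cofactor : ∀ n {m s} → 0 < m → m ≤ n → ∑[ a ≤ n ] 𝟙 (a * s ≡ᵇ m) ≡ 𝟙 (does (s ∣? m))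
∑-cofactor n {m} {s} 0<m m≤n with s ∣? m
... | no s∤m = ∑-vanishing n λ a _ _ →
  cong 𝟙 (dec-false (a * s ≟ m) λ as≡m → s∤m (divides a (sym as≡m)))
... | yes (divides q m≡qs) = unique-cofactor q s m≡qs
  where
  m≢0 : m ≢ 0
  m≢0 = ≢-sym (<⇒≢ 0<m)
  unique-cofactor : ∀ q s → m ≡ q * s → ∑[ a ≤ n ] 𝟙 (a * s ≡ᵇ m) ≡ 1
  unique-cofactor q         zero      m≡q*0 = contradiction (trans m≡q*0 (*-zeroʳ q)) m≢0
  unique-cofactor zero      (suc _)   m≡0   = contradiction m≡0 m≢0
  unique-cofactor q@(suc _) s@(suc _) m≡qs  =
    trans (∑-cong n cofactor≡q)
          (∑-δ n (λ _ → 1) z<s (≤-trans (subst (q ≤_) (sym m≡qs) (m≤m*n q s)) m≤n))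
    where
    cofactor≡q : ∀ a → 𝟙 (a * s ≡ᵇ m) ≡ 𝟙 (q ≡ᵇ a) * 1
    cofactor≡q a = trans
      (cong 𝟙 (does-⇔ (mk⇔ (λ as≡m → sym (*-cancelʳ-≡ a q s (trans as≡m m≡qs)))
                           (λ q≡a → trans (cong (_* s) (sym q≡a)) (sym m≡qs)))
                      (a * s ≟ m) (q ≟ a)))
      (sym (*-identityʳ _))

𝟙-∣-above : ∀ {n t} → 0 < n → n < t → 𝟙 (does (t ∣? n)) ≡ 0
𝟙-∣-above {n} {t} 0<n n<t = cong 𝟙 (dec-false (t ∣? n) (>⇒∤ {{>-nonZero 0<n}} n<t))

-- Counting functions on lists as sums
length-filter : ∀ {A : Set} {P : Pred A 0ℓ} (P? : Decidable P) xs →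
                length (filter P? xs) ≡ sum (map (λ x → 𝟙 (does (P? x))) xs)
length-filter P? []       = refl
length-filter P? (x ∷ xs) with does (P? x)
... | true  = cong suc (length-filter P? xs)
... | false = length-filter P? xs

sum-map-filter : ∀ {A : Set} {P : Pred A 0ℓ} (P? : Decidable P) (f : A → ℕ) xs →
                 sum (map f (filter P? xs)) ≡ sum (map (λ x → 𝟙 (does (P? x)) * f x) xs)
sum-map-filter P? f []       = refl
sum-map-filter P? f (x ∷ xs) with does (P? x)
... | true  = cong₂ _+_ (sym (+-identityʳ (f x))) (sum-map-filter P? f xs)
... | false = sum-map-filter P? f xs

sum-map-concatMap : ∀ {A B : Set} (f : B → ℕ) (g : A → List B) xs →
                    sum (map f (concatMap g xs)) ≡ sum (map (λ x → sum (map f (g x))) xs)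
sum-map-concatMap f g []       = refl
sum-map-concatMap f g (x ∷ xs) = begin
  sum (map f (g x ++ concatMap g xs))
    ≡⟨ cong sum (map-++ f (g x) (concatMap g xs)) ⟩
  sum (map f (g x) ++ map f (concatMap g xs))
    ≡⟨ sum-++ (map f (g x)) (map f (concatMap g xs)) ⟩
  sum (map f (g x)) + sum (map f (concatMap g xs))
    ≡⟨ cong (sum (map f (g x)) +_) (sum-map-concatMap f g xs) ⟩
  sum (map f (g x)) + sum (map (λ y → sum (map f (g y))) xs) ∎
  where open ≡-Reasoning

sum-map-range1 : ∀ n (f : ℕ → ℕ) → sum (map f (range1 n)) ≡ ∑ n f
sum-map-range1 zero    f = refl
sum-map-range1 (suc n) f = begin
  sum (map f (range1 (suc n)))
    ≡⟨ cong (sum ∘ map f) (sym (applyUpTo-∷ʳ suc n)) ⟩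
  sum (map f (range1 n ++ [ suc n ]))
    ≡⟨ cong sum (map-++ f (range1 n) [ suc n ]) ⟩
  sum (map f (range1 n) ++ [ f (suc n) ])
    ≡⟨ sum-++ (map f (range1 n)) [ f (suc n) ] ⟩
  sum (map f (range1 n)) + (f (suc n) + 0)
    ≡⟨ cong₂ _+_ (sum-map-range1 n f) (+-identityʳ (f (suc n))) ⟩
  ∑ (suc n) f ∎
  where open ≡-Reasoning

numDivisors≡∑ : ∀ n → numDivisors n ≡ ∑[ t ≤ n ] 𝟙 (does (t ∣? n))
numDivisors≡∑ n = trans (length-filter (_∣? n) (range1 n)) (sum-map-range1 n _)

sigma1≡∑ : ∀ n → sigma1 n ≡ ∑[ t ≤ n ] (t * 𝟙 (does (t ∣? n)))
sigma1≡∑ n = begin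
  sum (divisors n)
    ≡⟨ cong sum (sym (map-id (divisors n))) ⟩
  sum (map id (divisors n))
    ≡⟨ sum-map-filter (_∣? n) id (range1 n) ⟩
  sum (map (λ t → 𝟙 (does (t ∣? n)) * t) (range1 n))
    ≡⟨ sum-map-range1 n _ ⟩
  ∑[ t ≤ n ] (𝟙 (does (t ∣? n)) * t)
    ≡⟨ ∑-cong n (λ t → *-comm (𝟙 (does (t ∣? n))) t) ⟩
  ∑[ t ≤ n ] (t * 𝟙 (does (t ∣? n))) ∎
  where open ≡-Reasoning

parity-even : ∀ x → parity (2 * x) ≡ E
parity-even zero    = refl
parity-even (suc x) rewrite +-suc x (x + 0) = parity-even x

parity-odd : ∀ x → parity (1 + 2 * x) ≡ O
parity-odd zero    = refl
parity-odd (suc x) rewrite +-suc x (x + 0) = parity-odd x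

data ParityView : ℕ → Set where
  even : ∀ x → ParityView (2 * x)
  odd  : ∀ x → ParityView (1 + 2 * x)

parityView : ∀ n → ParityView n
parityView zero    = even 0
parityView (suc n) with parityView n
... | even x = odd x
... | odd  x = subst ParityView (*-suc 2 x) (even (suc x))

odd≢2* : ∀ {n} x → parity n ≡ O → n ≢ 2 * x
odd≢2* x n-odd refl with trans (sym n-odd) (parity-even x)
... | ()

odd⇒0< : ∀ {n} → parity n ≡ O → 0 < n
odd⇒0< n-odd = n≢0⇒n>0 (odd≢2* 0 n-odd)

2*∤odd : ∀ {n} x → parity n ≡ O → ¬ (2 * x ∣ n)
2*∤odd x n-odd (divides q n≡q*2x) = odd≢2* (q * x) n-odd (trans n≡q*2x (reassoc q x))
  where
  reassoc : ∀ q x → q * (2 * x) ≡ 2 * (q * x)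
  reassoc = solve-∀

odd∣2*⇒∣ : ∀ x n → 1 + 2 * x ∣ 2 * n → 1 + 2 * x ∣ n
odd∣2*⇒∣ x n (divides q 2n≡qt) with parityView q
... | even w = divides w (*-cancelˡ-≡ n (w * (1 + 2 * x)) 2 (trans 2n≡qt (*-assoc 2 w (1 + 2 * x))))
... | odd  w = contradiction (sym (trans 2n≡qt (odd*odd w x)))
                             (odd≢2* n (parity-odd (w + x + 2 * w * x)))
  where
  odd*odd : ∀ w x → (1 + 2 * w) * (1 + 2 * x) ≡ 1 + 2 * (w + x + 2 * w * x)
  odd*odd = solve-∀

-- Sums over [1 … n]⁴
∑⁴ : ℕ → (TwoSize → ℕ) → ℕ
∑⁴ n f = ∑[ a ≤ n ] ∑[ b ≤ n ] ∑[ c ≤ n ] ∑[ d ≤ n ] f (ts a b c d)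

∑⁴-cong : ∀ n {f g : TwoSize → ℕ} → f ≗ g → ∑⁴ n f ≡ ∑⁴ n g
∑⁴-cong n f≗g = ∑-cong n λ a → ∑-cong n λ b → ∑-cong n λ c → ∑-cong n λ d → f≗g (ts a b c d)

∑⁴-distrib-+ : ∀ n (f g : TwoSize → ℕ) → ∑⁴ n (λ p → f p + g p) ≡ ∑⁴ n f + ∑⁴ n g
∑⁴-distrib-+ n f g =
  trans (∑-cong n λ a → trans (∑-cong n λ b → trans (∑-cong n λ c →
           ∑-distrib-+ n _ _) (∑-distrib-+ n _ _)) (∑-distrib-+ n _ _))
        (∑-distrib-+ n _ _)

swapBlocks : TwoSize → TwoSize
swapBlocks (ts a b c d) = ts c d a b

transposeBlocks : TwoSize → TwoSize
transposeBlocks (ts a b c d) = ts b a d c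

∑⁴-swapBlocks : ∀ n (f : TwoSize → ℕ) → ∑⁴ n (f ∘ swapBlocks) ≡ ∑⁴ n f
∑⁴-swapBlocks n f = begin
  ∑[ a ≤ n ] ∑[ b ≤ n ] ∑[ c ≤ n ] ∑[ d ≤ n ] f (ts c d a b)
    ≡⟨ ∑-cong n (λ a → ∑-comm n n _) ⟩
  ∑[ a ≤ n ] ∑[ c ≤ n ] ∑[ b ≤ n ] ∑[ d ≤ n ] f (ts c d a b)
    ≡⟨ ∑-comm n n _ ⟩
  ∑[ c ≤ n ] ∑[ a ≤ n ] ∑[ b ≤ n ] ∑[ d ≤ n ] f (ts c d a b)
    ≡⟨ ∑-cong n (λ c → ∑-cong n λ a → ∑-comm n n _) ⟩
  ∑[ c ≤ n ] ∑[ a ≤ n ] ∑[ d ≤ n ] ∑[ b ≤ n ] f (ts c d a b)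
    ≡⟨ ∑-cong n (λ c → ∑-comm n n _) ⟩
  ∑[ c ≤ n ] ∑[ d ≤ n ] ∑[ a ≤ n ] ∑[ b ≤ n ] f (ts c d a b) ∎
  where open ≡-Reasoning

∑⁴-transposeBlocks : ∀ n (f : TwoSize → ℕ) → ∑⁴ n (f ∘ transposeBlocks) ≡ ∑⁴ n f
∑⁴-transposeBlocks n f = begin
  ∑[ a ≤ n ] ∑[ b ≤ n ] ∑[ c ≤ n ] ∑[ d ≤ n ] f (ts b a d c)
    ≡⟨ ∑-comm n n _ ⟩
  ∑[ b ≤ n ] ∑[ a ≤ n ] ∑[ c ≤ n ] ∑[ d ≤ n ] f (ts b a d c)
    ≡⟨ ∑-cong n (λ b → ∑-cong n λ a → ∑-comm n n _) ⟩
  ∑[ b ≤ n ] ∑[ a ≤ n ] ∑[ d ≤ n ] ∑[ c ≤ n ] f (ts b a d c) ∎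
  where open ≡-Reasoning

quadruples : ℕ → List TwoSize
quadruples n = concatMap (λ a → concatMap (λ b → concatMap (λ c → map (λ d → ts a b c d)
                 (range1 n)) (range1 n)) (range1 n)) (range1 n)

sum-map-quadruples : ∀ n (f : TwoSize → ℕ) → sum (map f (quadruples n)) ≡ ∑⁴ n f
sum-map-quadruples n f =
  trans (sum-map-concatMap-range1 _) (∑-cong n λ a →
  trans (sum-map-concatMap-range1 _) (∑-cong n λ b →
  trans (sum-map-concatMap-range1 _) (∑-cong n λ c →
  trans (cong sum (sym (map-∘ (range1 n)))) (sum-map-range1 n _))))
  where
  sum-map-concatMap-range1 : ∀ {A : Set} (g : ℕ → List A) {h : A → ℕ} →
    sum (map h (concatMap g (range1 n))) ≡ ∑[ x ≤ n ] sum (map h (g x))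
  sum-map-concatMap-range1 g {h} = trans (sum-map-concatMap h g (range1 n)) (sum-map-range1 n _)

countClass≡∑⁴ : ∀ A B C D N →
  countClass A B C D N ≡ ∑⁴ N (λ p → 𝟙 (isTwoSizePartitionOf N p ∧ hasClass A B C D p))
countClass≡∑⁴ A B C D N = begin
  length (filter class? (filter partition? (quadruples N)))
    ≡⟨ length-filter class? (filter partition? (quadruples N)) ⟩
  sum (map (λ p → 𝟙 (does (class? p))) (filter partition? (quadruples N)))
    ≡⟨ sum-map-filter partition? (λ p → 𝟙 (does (class? p))) (quadruples N) ⟩
  sum (map (λ p → 𝟙 (does (partition? p)) * 𝟙 (does (class? p))) (quadruples N))
    ≡⟨ cong sum (map-cong indicator (quadruples N)) ⟩
  sum (map (λ p → 𝟙 (isTwoSizePartitionOf N p ∧ hasClass A B C D p)) (quadruples N))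
    ≡⟨ sum-map-quadruples N _ ⟩
  ∑⁴ N (λ p → 𝟙 (isTwoSizePartitionOf N p ∧ hasClass A B C D p)) ∎
  where
  open ≡-Reasoning
  partition? class? : (p : TwoSize) → Dec (_ ≡ true)
  partition? p = isTwoSizePartitionOf N p Bool.≟ true
  class?     p = hasClass A B C D p Bool.≟ true
  indicator : ∀ p → 𝟙 (does (partition? p)) * 𝟙 (does (class? p))
                  ≡ 𝟙 (isTwoSizePartitionOf N p ∧ hasClass A B C D p)
  indicator p = trans (cong₂ (λ x y → 𝟙 x * 𝟙 y) (does-≟true (isTwoSizePartitionOf N p))
                                                  (does-≟true (hasClass A B C D p)))
                      (sym (𝟙-∧ (isTwoSizePartitionOf N p) (hasClass A B C D p)))

isUnorderedABAB : Parity → Parity → ℕ → TwoSize → Bool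
isUnorderedABAB A B N p = hasClass A B A B p ∧ (l₁ p * m₁ p + l₂ p * m₂ p ≡ᵇ N)

isUnorderedABAB-swapBlocks : ∀ A B N p →
  isUnorderedABAB A B N (swapBlocks p) ≡ isUnorderedABAB A B N p
isUnorderedABAB-swapBlocks A B N (ts a b c d) =
  cong₂ _∧_ (∧-swapPairs (parity c ≟ₚ A) (parity d ≟ₚ B) (parity a ≟ₚ A) (parity b ≟ₚ B))
            (cong (_≡ᵇ N) (+-comm (c * d) (a * b)))

isUnorderedABAB-transposeBlocks : ∀ A B N p →
  isUnorderedABAB A B N (transposeBlocks p) ≡ isUnorderedABAB B A N p
isUnorderedABAB-transposeBlocks A B N (ts a b c d) =
  cong₂ _∧_ (∧-swapWithinPairs (parity b ≟ₚ A) (parity a ≟ₚ B) (parity d ≟ₚ A) (parity c ≟ₚ B))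
            (cong (_≡ᵇ N) (cong₂ _+_ (*-comm b a) (*-comm d c)))

diagonal : Parity → Parity → ℕ → ℕ
diagonal A B N = ∑[ a ≤ N ] ∑[ b ≤ N ] ∑[ d ≤ N ] 𝟙 (isUnorderedABAB A B N (ts a b a d))

countClassABAB≡∑⁴ : ∀ A B N →
  countClass A B A B N ≡ ∑⁴ N (λ p → 𝟙 ((l₂ p <ᵇ l₁ p) ∧ isUnorderedABAB A B N p))
countClassABAB≡∑⁴ A B N = trans (countClass≡∑⁴ A B A B N) (∑⁴-cong N λ p →
  cong 𝟙 (trans (∧-assoc (l₂ p <ᵇ l₁ p) _ _)
                (cong ((l₂ p <ᵇ l₁ p) ∧_) (∧-comm _ (hasClass A B A B p)))))

∑⁴-equalSizes≡diagonal : ∀ A B N →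
  ∑⁴ N (λ p → 𝟙 ((l₁ p ≡ᵇ l₂ p) ∧ isUnorderedABAB A B N p)) ≡ diagonal A B N
∑⁴-equalSizes≡diagonal A B N = ∑-cong-≤ N λ a 0<a a≤N → ∑-cong N λ b → begin
  ∑[ c ≤ N ] ∑[ d ≤ N ] 𝟙 ((a ≡ᵇ c) ∧ U (ts a b c d))
    ≡⟨ ∑-comm N N _ ⟩
  ∑[ d ≤ N ] ∑[ c ≤ N ] 𝟙 ((a ≡ᵇ c) ∧ U (ts a b c d))
    ≡⟨ ∑-cong N (λ d → ∑-cong N λ c → 𝟙-∧ (a ≡ᵇ c) (U (ts a b c d))) ⟩
  ∑[ d ≤ N ] ∑[ c ≤ N ] (𝟙 (a ≡ᵇ c) * 𝟙 (U (ts a b c d)))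
    ≡⟨ ∑-cong N (λ d → ∑-δ N (λ c → 𝟙 (U (ts a b c d))) 0<a a≤N) ⟩
  ∑[ d ≤ N ] 𝟙 (U (ts a b a d)) ∎
  where
  open ≡-Reasoning
  U : TwoSize → Bool
  U = isUnorderedABAB A B N

unordered≡2*count+diagonal : ∀ A B N →
  ∑⁴ N (𝟙 ∘ isUnorderedABAB A B N) ≡ 2 * countClass A B A B N + diagonal A B N
unordered≡2*count+diagonal A B N = begin
  ∑⁴ N (𝟙 ∘ U)
    ≡⟨ ∑⁴-cong N (λ p → 𝟙-trichotomy (l₁ p) (l₂ p) (U p)) ⟩
  ∑⁴ N (λ p → ordered p + reversed p + equal p)
    ≡⟨ ∑⁴-distrib-+ N _ equal ⟩
  ∑⁴ N (λ p → ordered p + reversed p) + ∑⁴ N equal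
    ≡⟨ cong (_+ ∑⁴ N equal) (∑⁴-distrib-+ N ordered reversed) ⟩
  ∑⁴ N ordered + ∑⁴ N reversed + ∑⁴ N equal
    ≡⟨ cong₂ (λ x y → ∑⁴ N ordered + x + y) reversed≡ordered (∑⁴-equalSizes≡diagonal A B N) ⟩
  ∑⁴ N ordered + ∑⁴ N ordered + diagonal A B N
    ≡⟨ cong (λ x → x + x + diagonal A B N) (sym (countClassABAB≡∑⁴ A B N)) ⟩
  count + count + diagonal A B N
    ≡⟨ cong (λ x → count + x + diagonal A B N) (sym (+-identityʳ count)) ⟩
  2 * count + diagonal A B N ∎
  where
  open ≡-Reasoning
  U : TwoSize → Bool
  U = isUnorderedABAB A B N
  count : ℕ
  count = countClass A B A B N
  ordered reversed equal : TwoSize → ℕ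
  ordered  p = 𝟙 ((l₂ p <ᵇ l₁ p) ∧ U p)
  reversed p = 𝟙 ((l₁ p <ᵇ l₂ p) ∧ U p)
  equal    p = 𝟙 ((l₁ p ≡ᵇ l₂ p) ∧ U p)
  reversed≡ordered : ∑⁴ N reversed ≡ ∑⁴ N ordered
  reversed≡ordered = trans
    (∑⁴-cong N λ p → cong (λ b → 𝟙 ((l₁ p <ᵇ l₂ p) ∧ b)) (sym (isUnorderedABAB-swapBlocks A B N p)))
    (∑⁴-swapBlocks N ordered)

unordered-transposeBlocks : ∀ A B N →
  ∑⁴ N (𝟙 ∘ isUnorderedABAB A B N) ≡ ∑⁴ N (𝟙 ∘ isUnorderedABAB B A N)
unordered-transposeBlocks A B N =
  trans (∑⁴-cong N λ p → cong 𝟙 (sym (isUnorderedABAB-transposeBlocks B A N p)))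
        (∑⁴-transposeBlocks N (𝟙 ∘ isUnorderedABAB B A N))

diagonal-EO-term≡false : ∀ M → parity M ≡ O → ∀ a b d →
                   isUnorderedABAB E O (2 * M) (ts a b a d) ≡ false
diagonal-EO-term≡false M M-odd a b d with parityView a | parityView b | parityView d
... | odd  x | _      | _      rewrite parity-odd x = refl
... | even x | even y | _      rewrite parity-even x | parity-even y = refl
... | even x | odd y  | even z rewrite parity-even x | parity-odd y | parity-even z = refl
... | even x | odd y  | odd z  rewrite parity-even x | parity-odd y | parity-odd z =
  dec-false (2 * x * (1 + 2 * y) + 2 * x * (1 + 2 * z) ≟ 2 * M) λ eq →
    odd≢2* (x * (1 + y + z)) M-odd
      (sym (*-cancelˡ-≡ (2 * (x * (1 + y + z))) M 2 (trans (sym (multiple-of-4 x y z)) eq)))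
  where
  multiple-of-4 : ∀ x y z → 2 * x * (1 + 2 * y) + 2 * x * (1 + 2 * z) ≡ 2 * (2 * (x * (1 + y + z)))
  multiple-of-4 = solve-∀

diagonal-EO≡0 : ∀ M → parity M ≡ O → diagonal E O (2 * M) ≡ 0
diagonal-EO≡0 M M-odd = ∑-vanishing (2 * M) λ a _ _ → ∑-vanishing (2 * M) λ b _ _ →
  ∑-vanishing (2 * M) λ d _ _ → cong 𝟙 (diagonal-EO-term≡false M M-odd a b d)

diagonal-OE-term-odd-m₁ : ∀ N a y d → isUnorderedABAB O E N (ts a (1 + 2 * y) a d) ≡ false
diagonal-OE-term-odd-m₁ N a y d with parityView a
... | even x rewrite parity-even x = refl
... | odd  x rewrite parity-odd x | parity-odd y = refl

diagonal-OE-term-odd-m₂ : ∀ N a i z → isUnorderedABAB O E N (ts a (2 * i) a (1 + 2 * z)) ≡ false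
diagonal-OE-term-odd-m₂ N a i z with parityView a
... | even x rewrite parity-even x = refl
... | odd  x rewrite parity-odd x | parity-even i | parity-odd z = refl

diagonal-OE-term-even : ∀ M → parity M ≡ O → ∀ a i j →
  isUnorderedABAB O E (2 * M) (ts a (2 * i) a (2 * j)) ≡ (a * (i + j) ≡ᵇ M)
diagonal-OE-term-even M M-odd a i j with parityView a
... | even x rewrite parity-even x =
  sym (dec-false (2 * x * (i + j) ≟ M) λ eq →
    odd≢2* (x * (i + j)) M-odd (trans (sym eq) (*-assoc 2 x (i + j))))
... | odd  x rewrite parity-odd x | parity-even i | parity-even j =
  does-⇔ (mk⇔ (λ eq → *-cancelˡ-≡ (a′ * (i + j)) M 2 (trans (sym (double a′ i j)) eq))
              (λ eq → trans (double a′ i j) (cong (2 *_) eq)))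
         (a′ * (2 * i) + a′ * (2 * j) ≟ 2 * M) (a′ * (i + j) ≟ M)
  where
  a′ : ℕ
  a′ = 1 + 2 * x
  double : ∀ a i j → a * (2 * i) + a * (2 * j) ≡ 2 * (a * (i + j))
  double = solve-∀

diagonal-OE≡∑∑ : ∀ M → parity M ≡ O →
              diagonal O E (2 * M) ≡ ∑[ i ≤ M ] ∑[ j ≤ M ] 𝟙 (does ((i + j) ∣? M))
diagonal-OE≡∑∑ M M-odd = begin
  ∑[ a ≤ 2 * M ] ∑[ b ≤ 2 * M ] ∑[ d ≤ 2 * M ] 𝟙 (U (ts a b a d))
    ≡⟨ ∑-cong (2 * M) (λ a → ∑-evens M _ λ y →
         ∑-vanishing (2 * M) λ d _ _ → cong 𝟙 (diagonal-OE-term-odd-m₁ (2 * M) a y d)) ⟩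
  ∑[ a ≤ 2 * M ] ∑[ i ≤ M ] ∑[ d ≤ 2 * M ] 𝟙 (U (ts a (2 * i) a d))
    ≡⟨ ∑-cong (2 * M) (λ a → ∑-cong M λ i → ∑-evens M _ λ z →
         cong 𝟙 (diagonal-OE-term-odd-m₂ (2 * M) a i z)) ⟩
  ∑[ a ≤ 2 * M ] ∑[ i ≤ M ] ∑[ j ≤ M ] 𝟙 (U (ts a (2 * i) a (2 * j)))
    ≡⟨ ∑-cong (2 * M) (λ a → ∑-cong M λ i → ∑-cong M λ j →
         cong 𝟙 (diagonal-OE-term-even M M-odd a i j)) ⟩
  ∑[ a ≤ 2 * M ] ∑[ i ≤ M ] ∑[ j ≤ M ] 𝟙 (a * (i + j) ≡ᵇ M)
    ≡⟨ ∑-comm (2 * M) M _ ⟩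
  ∑[ i ≤ M ] ∑[ a ≤ 2 * M ] ∑[ j ≤ M ] 𝟙 (a * (i + j) ≡ᵇ M)
    ≡⟨ ∑-cong M (λ i → ∑-comm (2 * M) M _) ⟩
  ∑[ i ≤ M ] ∑[ j ≤ M ] ∑[ a ≤ 2 * M ] 𝟙 (a * (i + j) ≡ᵇ M)
    ≡⟨ ∑-cong M (λ i → ∑-cong M λ j → ∑-cofactor (2 * M) (odd⇒0< M-odd) (m≤n*m M 2)) ⟩
  ∑[ i ≤ M ] ∑[ j ≤ M ] 𝟙 (does ((i + j) ∣? M)) ∎
  where
  open ≡-Reasoning
  U : TwoSize → Bool
  U = isUnorderedABAB O E (2 * M)

numDivisors+diagonal-OE≡sigma1 : ∀ M → parity M ≡ O →
  numDivisors M + diagonal O E (2 * M) ≡ sigma1 M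
numDivisors+diagonal-OE≡sigma1 M M-odd = begin
  numDivisors M + diagonal O E (2 * M)
    ≡⟨ cong₂ _+_ (numDivisors≡∑ M) (diagonal-OE≡∑∑ M M-odd) ⟩
  ∑[ t ≤ M ] 𝟙 (does (t ∣? M)) + ∑[ i ≤ M ] ∑[ j ≤ M ] 𝟙 (does ((i + j) ∣? M))
    ≡⟨ ∑∑-convolution M (λ t → 𝟙 (does (t ∣? M))) (λ t → 𝟙-∣-above (odd⇒0< M-odd)) ⟩
  ∑[ t ≤ M ] (t * 𝟙 (does (t ∣? M)))
    ≡⟨ sym (sigma1≡∑ M) ⟩
  sigma1 M ∎
  where open ≡-Reasoning

-- An odd t divides 2M iff it divides M, and an even t = 2s divides 2M iff s divides M.
numDivisors-2*odd : ∀ M → parity M ≡ O → numDivisors (2 * M) ≡ 2 * numDivisors M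
numDivisors-2*odd M M-odd = begin
  numDivisors (2 * M)
    ≡⟨ numDivisors≡∑ (2 * M) ⟩
  ∑[ t ≤ 2 * M ] 𝟙 (does (t ∣? 2 * M))
    ≡⟨ ∑-cong (2 * M) split ⟩
  ∑[ t ≤ 2 * M ] (𝟙 (does (t ∣? M)) + evenDivisor t)
    ≡⟨ ∑-distrib-+ (2 * M) _ evenDivisor ⟩
  ∑[ t ≤ 2 * M ] 𝟙 (does (t ∣? M)) + ∑ (2 * M) evenDivisor
    ≡⟨ cong₂ _+_ (∑-extend (m≤n*m M 2) (λ t → 𝟙-∣-above (odd⇒0< M-odd)))
                 (∑-evens M evenDivisor oddIndex) ⟩
  ∑[ t ≤ M ] 𝟙 (does (t ∣? M)) + ∑[ s ≤ M ] evenDivisor (2 * s)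
    ≡⟨ cong₂ _+_ (sym (numDivisors≡∑ M)) (trans (∑-cong M halve) (sym (numDivisors≡∑ M))) ⟩
  numDivisors M + numDivisors M
    ≡⟨ cong (numDivisors M +_) (sym (+-identityʳ _)) ⟩
  2 * numDivisors M ∎
  where
  open ≡-Reasoning
  evenDivisor : ℕ → ℕ
  evenDivisor t = 𝟙 ((parity t ≟ₚ E) ∧ does (t ∣? 2 * M))
  split : ∀ t → 𝟙 (does (t ∣? 2 * M)) ≡ 𝟙 (does (t ∣? M)) + evenDivisor t
  split t with parityView t
  ... | even x rewrite parity-even x =
    cong (_+ 𝟙 (does (2 * x ∣? 2 * M))) (sym (cong 𝟙 (dec-false (2 * x ∣? M) (2*∤odd x M-odd))))
  ... | odd  x rewrite parity-odd x =
    trans (cong 𝟙 (does-⇔ (mk⇔ (odd∣2*⇒∣ x M) (∣n⇒∣m*n 2)) (1 + 2 * x ∣? 2 * M) (1 + 2 * x ∣? M)))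
          (sym (+-identityʳ _))
  oddIndex : ∀ j → evenDivisor (1 + 2 * j) ≡ 0
  oddIndex j rewrite parity-odd j = refl
  halve : ∀ s → evenDivisor (2 * s) ≡ 𝟙 (does (s ∣? M))
  halve s rewrite parity-even s =
    cong 𝟙 (does-⇔ (mk⇔ (*-cancelˡ-∣ 2) (*-monoʳ-∣ 2)) (2 * s ∣? 2 * M) (s ∣? M))

2*EOEO≡2*OEOE+diagonal : ∀ M → parity M ≡ O →
  2 * countClass E O E O (2 * M) ≡ 2 * countClass O E O E (2 * M) + diagonal O E (2 * M)
2*EOEO≡2*OEOE+diagonal M M-odd = begin
  2 * countClass E O E O N
    ≡⟨ sym (trans (cong (2 * countClass E O E O N +_) (diagonal-EO≡0 M M-odd)) (+-identityʳ _)) ⟩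
  2 * countClass E O E O N + diagonal E O N
    ≡⟨ sym (unordered≡2*count+diagonal E O N) ⟩
  ∑⁴ N (𝟙 ∘ isUnorderedABAB E O N)
    ≡⟨ unordered-transposeBlocks E O N ⟩
  ∑⁴ N (𝟙 ∘ isUnorderedABAB O E N)
    ≡⟨ unordered≡2*count+diagonal O E N ⟩
  2 * countClass O E O E N + diagonal O E N ∎
  where
  open ≡-Reasoning
  N : ℕ
  N = 2 * M

EOEO-OEOE-identity : ∀ M → parity M ≡ O →
  4 * countClass E O E O (2 * M) + numDivisors (2 * M)
    ≡ 4 * countClass O E O E (2 * M) + 2 * sigma1 M
EOEO-OEOE-identity M M-odd = begin
  4 * EOEO + numDivisors (2 * M)
    ≡⟨ cong₂ _+_ (*-assoc 2 2 EOEO) (numDivisors-2*odd M M-odd) ⟩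
  2 * (2 * EOEO) + 2 * numDivisors M
    ≡⟨ cong (λ x → 2 * x + 2 * numDivisors M) (2*EOEO≡2*OEOE+diagonal M M-odd) ⟩
  2 * (2 * OEOE + diagonal O E (2 * M)) + 2 * numDivisors M
    ≡⟨ regroup OEOE (diagonal O E (2 * M)) (numDivisors M) ⟩
  4 * OEOE + 2 * (numDivisors M + diagonal O E (2 * M))
    ≡⟨ cong (λ x → 4 * OEOE + 2 * x) (numDivisors+diagonal-OE≡sigma1 M M-odd) ⟩
  4 * OEOE + 2 * sigma1 M ∎
  where
  open ≡-Reasoning
  EOEO OEOE : ℕ
  EOEO = countClass E O E O (2 * M)
  OEOE = countClass O E O E (2 * M)
  regroup : ∀ o x d → 2 * (2 * o + x) + 2 * d ≡ 4 * o + 2 * (d + x)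
  regroup = solve-∀

4k+2≡2*[2k+1] : ∀ k → 4 * k + 2 ≡ 2 * (2 * k + 1)
4k+2≡2*[2k+1] = solve-∀

lemma4p1 : (k : ℕ) →
    4 * countClass E O E O (4 * k + 2) + numDivisors (4 * k + 2)
      ≡ 4 * countClass O E O E (4 * k + 2) + 2 * sigma1 (2 * k + 1)
lemma4p1 k rewrite 4k+2≡2*[2k+1] k =
  EOEO-OEOE-identity (2 * k + 1) (trans (cong parity (+-comm (2 * k) 1)) (parity-odd k))
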